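{- Let $s,n\geq 2$ be integers and put $t=n+s-1$. Suppose that $(n+\sqrt{t})/s$ is not an integer and that $\left\lceil (n+\sqrt{t})/s\right\rceil\leq \lfloor (n+1)/s\rfloor+1$. Then $$M_s(n)=\left\lceil \frac{n+\sqrt{t}}{s}\right\rceil+1.$$
   Context: For integers $c,s\geq 1$, $K_{c\times s}$ denotes the complete multipartite graph with $c$ classes of $s$ vertices each. For a subgraph $H$ of $K_{c\times s}$, $\overline{H}$ denotes the complement of $H$ relative to $K_{c\times s}$. $C_4$ is the $4$-cycle and $K_{1,n}$ is the star with $n+1$ vertices. $M_s(n)$ is the smallest positive integer $c$ such that for every subgraph $H$ of $K_{c\times s}$, $H$ contains a copy of $C_4$ or $\overline{H}$ contains a copy of $K_{1,n}$. -}

module Defs where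

open import Data.Nat using (ℕ; zero; suc; _+_; _*_; _∸_; _^_; _≤_; _<_)
open import Data.Fin using (Fin)
open import Data.Bool using (Bool; true; false)
open import Data.Product using (Σ; _×_; _,_; ∃; ∃-syntax)
open import Relation.Binary.PropositionalEquality using (_≡_; _≢_)
open import Relation.Nullary using (¬_)
open import Function.Definitions using (Injective)

-- Vertices of K_{c×s}: (class, index within class).
Vertex : ℕ → ℕ → Set
Vertex c s = Fin c × Fin s

classOf : ∀ {c s} → Vertex c s → Fin c
classOf (i , _) = i

KEdge : ∀ {c s} → Vertex c s → Vertex c s → Set
KEdge u v = classOf u ≢ classOf v

-- A (spanning) subgraph H of K_{c×s}: a symmetric Boolean labelling of
-- pairs; its edges are the pairs of K_{c×s} labelled true, and the edges
-- of the complement H̄ (relative to K_{c×s}) are the pairs labelled false.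
record Subgraph (c s : ℕ) : Set where
  field
    adj  : Vertex c s → Vertex c s → Bool
    sym  : ∀ u v → adj u v ≡ adj v u
open Subgraph public

HEdge : ∀ {c s} → Subgraph c s → Vertex c s → Vertex c s → Set
HEdge H u v = KEdge u v × adj H u v ≡ true

CoEdge : ∀ {c s} → Subgraph c s → Vertex c s → Vertex c s → Set
CoEdge H u v = KEdge u v × adj H u v ≡ false

HasC4 : ∀ {c s} → Subgraph c s → Set
HasC4 {c} {s} H =
  Σ (Vertex c s) λ v0 → Σ (Vertex c s) λ v1 →
  Σ (Vertex c s) λ v2 → Σ (Vertex c s) λ v3 →
    (v0 ≢ v1) × (v0 ≢ v2) × (v0 ≢ v3) × (v1 ≢ v2) × (v1 ≢ v3) × (v2 ≢ v3) ×
    HEdge H v0 v1 × HEdge H v1 v2 × HEdge H v2 v3 × HEdge H v3 v0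

CoHasStar : ∀ {c s} → ℕ → Subgraph c s → Set
CoHasStar {c} {s} n H =
  Σ (Vertex c s) λ v → Σ (Fin n → Vertex c s) λ f →
    Injective _≡_ _≡_ f × (∀ i → f i ≢ v) × (∀ i → CoEdge H v (f i))

RamseyProp : ℕ → ℕ → ℕ → Set
RamseyProp s n c = (H : Subgraph c s) → HasC4 H Data.Sum.⊎ CoHasStar n H
  where import Data.Sum

MsnIs : ℕ → ℕ → ℕ → Set
MsnIs s n m = 1 ≤ m × RamseyProp s n m × (∀ c → 1 ≤ c → c < m → ¬ RamseyProp s n c)

-- Real-number arithmetic with √t, expressed exactly over ℕ.
-- k·s ≥ n + √t  ⟺  n ≤ k·s  and  t ≤ (k·s − n)².
AtLeastNSqrt : ℕ → ℕ → ℕ → ℕ → Set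
AtLeastNSqrt s n t k = n ≤ k * s × t ≤ (k * s ∸ n) ^ 2

IsCeilNSqrtDiv : ℕ → ℕ → ℕ → ℕ → Set
IsCeilNSqrtDiv s n t m = AtLeastNSqrt s n t m × (∀ k → k < m → ¬ AtLeastNSqrt s n t k)

NSqrtDivIsInteger : ℕ → ℕ → ℕ → Set
NSqrtDivIsInteger s n t = ∃[ k ] (n ≤ k * s × (k * s ∸ n) ^ 2 ≡ t)

module Submission where

-- Put k = m s − n, so that (m + 1) s = s + k + n, and k² ≥ n + s because m s > n + √t.
-- Upper bound: if H ⊆ K_{(m+1)×s} has no C4 and every vertex has fewer than n
-- non-neighbours in other classes, then every vertex has at least k + 1 neighbours.
-- As two vertices have at most one common neighbour, a vertex, its neighbours and
-- their further neighbours are 1 + (k + 1) + (k + 1)(k − 1) = k² + k + 1 > (m + 1) s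
-- distinct vertices.
-- Lower bound: for c ≤ m we have c s ≤ n + 1 + s. Numbering the vertices so that
-- consecutive ones lie in different classes, the Hamiltonian cycle through them
-- (a path when c s < 5) is C4-free and leaves every vertex fewer than n
-- non-neighbours in other classes.

open import Defs hiding (sym)
open import Data.Nat
  using (ℕ; zero; suc; pred; _+_; _∸_; _*_; _≤_; _<_; _/_; NonZero; >-nonZero; z≤n; s≤s; s≤s⁻¹)
open import Relation.Nullary using (¬_)

open import Algebra.Properties.CommutativeSemigroup as CSProps using ()
open import Data.Bool using (true; false)
import Data.Bool.Properties as 𝔹
open import Data.Empty using (⊥; ⊥-elim)
open import Data.Fin using (Fin; zero; suc; toℕ; fromℕ<; inject≤; combine; remQuot; punchOut)
import Data.Fin.Properties as FP
open import Data.List using (List; []; _∷_; _++_; length; filter; lookup; map; allFin; concatMap)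
open import Data.List.Properties using (length-map; length-++; length-tabulate)
open import Data.List.Membership.Propositional using (_∈_; _∉_; find)
import Data.List.Membership.DecPropositional as DecMembership
open import Data.List.Membership.Propositional.Properties
  using (∈-lookup; ∈-filter⁻; ∈-map⁻; ∈-++⁻; ∈-concatMap⁻)
open import Data.List.Relation.Unary.All as All using (All; []; _∷_)
open import Data.List.Relation.Unary.All.Properties using (all-filter; ++⁺)
open import Data.List.Relation.Unary.AllPairs using ([]; _∷_)
open import Data.List.Relation.Unary.Any using (here; there)
open import Data.List.Relation.Unary.Unique.Propositional using (Unique)
import Data.List.Relation.Unary.Unique.Propositional.Properties as Unique
open import Data.Nat.Divisibility using (_∣_; ∣m+n∣m⇒∣n; ∣m∣n⇒∣m+n; m∣m*n; n∣m*n; ∣1⇒≡1)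
open import Data.Nat.DivMod using (m/n*n≤m)
open import Data.Nat.Properties
open import Data.Product using (∃; ∃₂; _×_; _,_; proj₁; proj₂; swap; uncurry)
open import Data.Product.Properties using (≡-dec)
open import Data.Sum using (_⊎_; inj₁; inj₂)
import Data.Sum as Sum
open import Data.Unit using (tt)
open import Function using (_∘_; mk⇔)
open import Level using (0ℓ)
open import Function.Definitions using (Injective)
open import Relation.Binary.Definitions using (DecidableEquality)
open import Relation.Binary.PropositionalEquality
open import Relation.Nullary using (Dec; yes; no; does; ¬?; _×-dec_; _⊎-dec_)
open import Relation.Nullary.Decidable using (map′; toSum; dec-true; does-⇔)
open import Relation.Unary using (Pred; Decidable; _∪_)
open import Relation.Unary.Properties using (∁?)

module _ {A : Set} where

  lookup-injective : ∀ {xs : List A} → Unique xs → ∀ {i j} → lookup xs i ≡ lookup xs j → i ≡ j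
  lookup-injective {_ ∷ _} (_ ∷ _) {zero} {zero} _ = refl
  lookup-injective {_ ∷ _} (x∉ ∷ _) {zero} {suc j} eq = ⊥-elim (All.lookup x∉ (∈-lookup j) eq)
  lookup-injective {_ ∷ _} (x∉ ∷ _) {suc i} {zero} eq = ⊥-elim (All.lookup x∉ (∈-lookup i) (sym eq))
  lookup-injective {_ ∷ _} (_ ∷ xs!) {suc i} {suc j} eq = cong suc (lookup-injective xs! eq)

  encoding⇒length≤ : ∀ {K} {P : Pred A 0ℓ} (enc : ∀ a → P a → Fin K) →
    (∀ {a b} (p : P a) (q : P b) → enc a p ≡ enc b q → a ≡ b) →
    ∀ {xs} → Unique xs → All P xs → length xs ≤ K
  encoding⇒length≤ enc enc-injective {xs} xs! pxs =
    FP.injective⇒≤ {f = λ i → enc (lookup xs i) (All.lookup pxs (∈-lookup i))}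
      (λ eq → lookup-injective xs! (enc-injective _ _ eq))

  length≤1 : ∀ {xs : List A} → Unique xs → (∀ {x y} → x ∈ xs → y ∈ xs → x ≡ y) → length xs ≤ 1
  length≤1 {xs} xs! all-equal =
    encoding⇒length≤ {P = _∈ xs} (λ _ _ → zero) (λ x∈ y∈ _ → all-equal x∈ y∈) xs! (All.tabulate (λ x∈ → x∈))

  length≤filter+filter : ∀ {P Q : Pred A 0ℓ} (P? : Decidable P) (Q? : Decidable Q) {xs} →
    All (P ∪ Q) xs → length xs ≤ length (filter P? xs) + length (filter Q? xs)
  length≤filter+filter P? Q? [] = z≤n
  length≤filter+filter P? Q? {x ∷ xs} (px⊎qx ∷ pqs)
    with P? x | Q? x | length≤filter+filter P? Q? pqs
  ... | yes _ | yes _ | ih = s≤s (≤-trans ih (+-monoʳ-≤ _ (n≤1+n _)))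
  ... | yes _ | no _  | ih = s≤s ih
  ... | no _  | yes _ | ih = ≤-trans (s≤s ih) (≤-reflexive (sym (+-suc _ _)))
  ... | no ¬px | no ¬qx | _ with px⊎qx
  ...   | inj₁ px = ⊥-elim (¬px px)
  ...   | inj₂ qx = ⊥-elim (¬qx qx)

  length≤filter+filter-∁ : ∀ {P : Pred A 0ℓ} (P? : Decidable P) xs →
    length xs ≤ length (filter P? xs) + length (filter (∁? P?) xs)
  length≤filter+filter-∁ P? xs = length≤filter+filter P? (∁? P?) (All.universal (toSum ∘ P?) xs)

module _ {A B : Set} (f : A → List B) where

  concatMap-unique : ∀ {xs} → Unique xs → All (Unique ∘ f) xs →
    (∀ {x y z} → x ∈ xs → y ∈ xs → z ∈ f x → z ∈ f y → x ≡ y) → Unique (concatMap f xs)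
  concatMap-unique {[]} _ _ _ = []
  concatMap-unique {x ∷ xs} (x∉ ∷ xs!) (fx! ∷ fxs!) owner =
    Unique.++⁺ fx! (concatMap-unique xs! fxs! (λ x∈ y∈ → owner (there x∈) (there y∈))) disjoint
    where
    disjoint : ∀ {z} → ¬ (z ∈ f x × z ∈ concatMap f xs)
    disjoint (z∈fx , z∈rest) with find (∈-concatMap⁻ f z∈rest)
    ... | y , y∈xs , z∈fy = All.lookup x∉ y∈xs (owner (here refl) (there y∈xs) z∈fx z∈fy)

  length-concatMap-≥ : ∀ {k} xs → All (λ x → k ≤ suc (length (f x))) xs →
    length xs * k ≤ length xs + length (concatMap f xs)
  length-concatMap-≥ [] [] = z≤n
  length-concatMap-≥ {k} (x ∷ xs) (k≤ ∷ k≤s) = begin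
    k + length xs * k
      ≤⟨ +-mono-≤ k≤ (length-concatMap-≥ xs k≤s) ⟩
    suc (length (f x) + (length xs + length (concatMap f xs)))
      ≡⟨ cong suc (x∙yz≈y∙xz (length (f x)) (length xs) _) ⟩
    suc (length xs + (length (f x) + length (concatMap f xs)))
      ≡⟨ cong (λ (l : ℕ) → suc (length xs + l)) (length-++ (f x) {concatMap f xs}) ⟨
    suc (length xs + length (f x ++ concatMap f xs)) ∎
    where
    open ≤-Reasoning
    open CSProps +-commutativeSemigroup using (x∙yz≈y∙xz)

module Vertices (c s : ℕ) where

  V : Set
  V = Vertex c s

  _≟ᵥ_ : DecidableEquality V
  _≟ᵥ_ = ≡-dec FP._≟_ FP._≟_

  open DecMembership _≟ᵥ_ public using (_∈?_)

  any-vertex? : {P : Pred V 0ℓ} → Decidable P → Dec (∃ P)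
  any-vertex? P? = map′ (λ (i , x , p) → (i , x) , p) (λ ((i , x) , p) → i , x , p)
    (FP.any? (λ i → FP.any? (λ x → P? (i , x))))

  vertices : List V
  vertices = map (remQuot {c} s) (allFin (c * s))

  length-vertices : length vertices ≡ c * s
  length-vertices = trans (length-map (remQuot {c} s) (allFin (c * s))) (length-tabulate (λ i → i))

  vertices-unique : Unique vertices
  vertices-unique = Unique.map⁺ remQuot-injective (Unique.allFin⁺ (c * s))
    where
    remQuot-injective : ∀ {i j} → remQuot {c} s i ≡ remQuot s j → i ≡ j
    remQuot-injective {i} {j} eq = begin
      i                                  ≡⟨ FP.combine-remQuot {c} s i ⟨
      uncurry combine (remQuot {c} s i)  ≡⟨ cong (uncurry combine) eq ⟩
      uncurry combine (remQuot {c} s j)  ≡⟨ FP.combine-remQuot {c} s j ⟩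
      j                                  ∎
      where open ≡-Reasoning

  unique⇒length≤ : ∀ {vs} → Unique vs → length vs ≤ c * s
  unique⇒length≤ {vs} vs! =
    encoding⇒length≤ (λ (i , x) _ → combine i x) combine-injective vs! (All.universal (λ _ → tt) vs)
    where
    combine-injective : ∀ {u w : V} _ _ → combine (proj₁ u) (proj₂ u) ≡ combine (proj₁ w) (proj₂ w) → u ≡ w
    combine-injective {i , x} {j , y} _ _ eq with FP.combine-injective i x j y eq
    ... | refl , refl = refl

  sameClass? : ∀ (v : V) → Decidable (λ (w : V) → classOf v ≡ classOf w)
  sameClass? v w = classOf v FP.≟ classOf w

  KEdge? : ∀ (v : V) → Decidable (KEdge v)
  KEdge? v = ∁? (sameClass? v)

  others : V → List V
  others v = filter (KEdge? v) vertices

  others-unique : ∀ (v : V) → Unique (others v)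
  others-unique v = Unique.filter⁺ (KEdge? v) vertices-unique

  cs≤s+others : ∀ (v : V) → c * s ≤ s + length (others v)
  cs≤s+others v = begin
    c * s                                                          ≡⟨ length-vertices ⟨
    length vertices                                                ≤⟨ length≤filter+filter-∁ (sameClass? v) vertices ⟩
    length (filter (sameClass? v) vertices) + length (others v)    ≤⟨ +-monoˡ-≤ _ same-class≤s ⟩
    s + length (others v)                                          ∎
    where
    open ≤-Reasoning
    same-class≤s : length (filter (sameClass? v) vertices) ≤ s
    same-class≤s = encoding⇒length≤ (λ w _ → proj₂ w) index-injective
      (Unique.filter⁺ (sameClass? v) vertices-unique) (all-filter (sameClass? v) vertices)
      where
      index-injective : ∀ {u w : V} → classOf v ≡ classOf u → classOf v ≡ classOf w → proj₂ u ≡ proj₂ w → u ≡ w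
      index-injective {_ , x} {_ , .x} refl refl refl = refl

otherClasses⇒length≤ : ∀ {c s} {v : Vertex (suc c) s} {vs} → Unique vs → All (KEdge v) vs → length vs ≤ c * s
otherClasses⇒length≤ {c} {s} {v} = encoding⇒length≤ (λ (j , x) j≢ → combine (punchOut j≢) x) encoding-injective
  where
  encoding-injective : ∀ {u w : Vertex (suc c) s} (p : KEdge v u) (q : KEdge v w) →
    combine (punchOut p) (proj₂ u) ≡ combine (punchOut q) (proj₂ w) → u ≡ w
  encoding-injective {j , x} {k , y} p q eq with FP.combine-injective (punchOut p) x (punchOut q) y eq
  ... | j≡k , refl with FP.punchOut-injective p q j≡k
  ... | refl = refl

module Neighbourhoods {c s : ℕ} (H : Subgraph c s) where
  open Vertices c s

  HEdge? : ∀ (v : V) → Decidable (HEdge H v)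
  HEdge? v w = KEdge? v w ×-dec (adj H v w 𝔹.≟ true)

  CoEdge? : ∀ (v : V) → Decidable (CoEdge H v)
  CoEdge? v w = KEdge? v w ×-dec (adj H v w 𝔹.≟ false)

  HEdge-sym : ∀ {u w : V} → HEdge H u w → HEdge H w u
  HEdge-sym {u} {w} (u≁w , uw) = u≁w ∘ sym , trans (Subgraph.sym H w u) uw

  HEdge⇒≢ : ∀ {u w : V} → HEdge H u w → u ≢ w
  HEdge⇒≢ (u≁w , _) refl = u≁w refl

  nbrs : V → List V
  nbrs v = filter (HEdge? v) (others v)

  coNbrs : V → List V
  coNbrs v = filter (CoEdge? v) (others v)

  nbrs-unique : ∀ v → Unique (nbrs v)
  nbrs-unique v = Unique.filter⁺ (HEdge? v) (others-unique v)

  ∈-nbrs⁻ : ∀ {v w} → w ∈ nbrs v → HEdge H v w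
  ∈-nbrs⁻ {v} w∈ = proj₂ (∈-filter⁻ (HEdge? v) {xs = others v} w∈)

  cs≤s+deg+codeg : ∀ v → c * s ≤ s + (length (nbrs v) + length (coNbrs v))
  cs≤s+deg+codeg v = ≤-trans (cs≤s+others v) (+-monoʳ-≤ s
    (length≤filter+filter (HEdge? v) (CoEdge? v) (All.map edge-or-coedge (all-filter (KEdge? v) vertices))))
    where
    edge-or-coedge : ∀ {w} → KEdge v w → HEdge H v w ⊎ CoEdge H v w
    edge-or-coedge {w} v≁w with adj H v w
    ... | true = inj₁ (v≁w , refl)
    ... | false = inj₂ (v≁w , refl)

  coStar : ∀ {n} v → n ≤ length (coNbrs v) → CoHasStar n H
  coStar v n≤ = v , leaf , leaf-injective , leaf≢v , leaf-coedge
    where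
    leaf = λ i → lookup (coNbrs v) (inject≤ i n≤)
    leaf-injective : Injective _≡_ _≡_ leaf
    leaf-injective eq = FP.inject≤-injective n≤ n≤ _ _
      (lookup-injective (Unique.filter⁺ (CoEdge? v) (others-unique v)) eq)
    leaf-coedge : ∀ i → CoEdge H v (leaf i)
    leaf-coedge i = All.lookup (all-filter (CoEdge? v) (others v)) (∈-lookup (inject≤ i n≤))
    leaf≢v : ∀ i → leaf i ≢ v
    leaf≢v i eq = proj₁ (leaf-coedge i) (cong classOf (sym eq))

  hasC4? : Dec (HasC4 H)
  hasC4? = any-vertex? λ v₀ → any-vertex? λ v₁ → any-vertex? λ v₂ → any-vertex? λ v₃ →
    ¬? (v₀ ≟ᵥ v₁) ×-dec ¬? (v₀ ≟ᵥ v₂) ×-dec ¬? (v₀ ≟ᵥ v₃) ×-dec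
    ¬? (v₁ ≟ᵥ v₂) ×-dec ¬? (v₁ ≟ᵥ v₃) ×-dec ¬? (v₂ ≟ᵥ v₃) ×-dec
    HEdge? v₀ v₁ ×-dec HEdge? v₁ v₂ ×-dec HEdge? v₂ v₃ ×-dec HEdge? v₃ v₀

-- The Moore bound for C4-free graphs

module C4Free {c s : ℕ} {H : Subgraph c s} (noC4 : ¬ HasC4 H) where
  open Vertices c s
  open Neighbourhoods H

  common-neighbour-unique : ∀ {a b x y} → a ≢ b →
    HEdge H a x → HEdge H x b → HEdge H a y → HEdge H y b → x ≡ y
  common-neighbour-unique a≢b ax xb ay yb with _ ≟ᵥ _
  ... | yes x≡y = x≡y
  ... | no x≢y = ⊥-elim (noC4 (_ , _ , _ , _ ,
    HEdge⇒≢ ax , a≢b , HEdge⇒≢ ay , HEdge⇒≢ xb , x≢y , HEdge⇒≢ (HEdge-sym yb) ,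
    ax , xb , HEdge-sym yb , HEdge-sym ay))

  -- Two vertices have at most one common neighbour, so v, A = N(v) and the sets
  -- fresh u (u ∈ A) are pairwise disjoint.
  module Ball (k : ℕ) (deg≥ : ∀ u → suc k ≤ length (nbrs u)) (v : V) where

    A : List V
    A = nbrs v

    outside : V → List V
    outside u = filter (∁? (_∈? A)) (nbrs u)

    fresh : V → List V
    fresh u = filter (∁? (_≟ᵥ v)) (outside u)

    ∈-fresh⁻ : ∀ {u z} → z ∈ fresh u → HEdge H u z × z ∉ A × z ≢ v
    ∈-fresh⁻ {u} z∈ with ∈-filter⁻ (∁? (_≟ᵥ v)) {xs = outside u} z∈
    ... | z∈out , z≢v with ∈-filter⁻ (∁? (_∈? A)) {xs = nbrs u} z∈out
    ... | z∈nbrs , z∉A = ∈-nbrs⁻ z∈nbrs , z∉A , z≢v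

    fresh-owner : ∀ {u u' z} → u ∈ A → u' ∈ A → z ∈ fresh u → z ∈ fresh u' → u ≡ u'
    fresh-owner u∈A u'∈A z∈ z∈' with ∈-fresh⁻ z∈ | ∈-fresh⁻ z∈'
    ... | uz , _ , z≢v | u'z , _ , _ =
      common-neighbour-unique (z≢v ∘ sym) (∈-nbrs⁻ u∈A) uz (∈-nbrs⁻ u'∈A) u'z

    fresh-large : ∀ {u} → u ∈ A → k ≤ suc (length (fresh u))
    fresh-large {u} u∈A = s≤s⁻¹ (begin
      suc k                                              ≤⟨ deg≥ u ⟩
      length (nbrs u)                                    ≤⟨ length≤filter+filter-∁ (_∈? A) (nbrs u) ⟩
      length inside + length (outside u)                 ≤⟨ +-mono-≤ inside≤1 (length≤filter+filter-∁ (_≟ᵥ v) (outside u)) ⟩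
      1 + (length (filter (_≟ᵥ v) (outside u)) + length (fresh u))
                                                         ≤⟨ +-monoʳ-≤ 1 (+-monoˡ-≤ _ at-most-v) ⟩
      2 + length (fresh u)                               ∎)
      where
      open ≤-Reasoning
      inside = filter (_∈? A) (nbrs u)
      inside≤1 : length inside ≤ 1
      inside≤1 = length≤1 (Unique.filter⁺ (_∈? A) (nbrs-unique u)) λ x∈ y∈ →
        let x∈nbrs , x∈A = ∈-filter⁻ (_∈? A) {xs = nbrs u} x∈
            y∈nbrs , y∈A = ∈-filter⁻ (_∈? A) {xs = nbrs u} y∈
        in common-neighbour-unique (HEdge⇒≢ (∈-nbrs⁻ u∈A))
             (∈-nbrs⁻ x∈A) (HEdge-sym (∈-nbrs⁻ x∈nbrs)) (∈-nbrs⁻ y∈A) (HEdge-sym (∈-nbrs⁻ y∈nbrs))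
      at-most-v : length (filter (_≟ᵥ v) (outside u)) ≤ 1
      at-most-v = length≤1 (Unique.filter⁺ (_≟ᵥ v) (Unique.filter⁺ (∁? (_∈? A)) (nbrs-unique u))) λ x∈ y∈ →
        trans (proj₂ (∈-filter⁻ (_≟ᵥ v) {xs = outside u} x∈)) (sym (proj₂ (∈-filter⁻ (_≟ᵥ v) {xs = outside u} y∈)))

    ball : List V
    ball = v ∷ A ++ concatMap fresh A

    ball-unique : Unique ball
    ball-unique = All.tabulate v∉ ∷ Unique.++⁺ (nbrs-unique v) fresh-unique A-disjoint
      where
      fresh-unique : Unique (concatMap fresh A)
      fresh-unique = concatMap-unique fresh (nbrs-unique v)
        (All.tabulate (λ {u} _ → Unique.filter⁺ (∁? (_≟ᵥ v)) (Unique.filter⁺ (∁? (_∈? A)) (nbrs-unique u))))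
        fresh-owner
      A-disjoint : ∀ {z} → ¬ (z ∈ A × z ∈ concatMap fresh A)
      A-disjoint (z∈A , z∈fresh) with find (∈-concatMap⁻ fresh {xs = A} z∈fresh)
      ... | _ , _ , z∈ = proj₁ (proj₂ (∈-fresh⁻ z∈)) z∈A
      v∉ : ∀ {z} → z ∈ A ++ concatMap fresh A → v ≢ z
      v∉ z∈ with ∈-++⁻ A z∈
      ... | inj₁ z∈A = HEdge⇒≢ (∈-nbrs⁻ z∈A)
      ... | inj₂ z∈fresh with find (∈-concatMap⁻ fresh {xs = A} z∈fresh)
      ...   | _ , _ , z∈ = proj₂ (proj₂ (∈-fresh⁻ z∈)) ∘ sym

    moore-bound : suc k * k < c * s
    moore-bound = begin-strict
      suc k * k                               ≤⟨ *-monoˡ-≤ k (deg≥ v) ⟩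
      length A * k                            ≤⟨ length-concatMap-≥ fresh A (All.tabulate fresh-large) ⟩
      length A + length (concatMap fresh A)   ≡⟨ length-++ A ⟨
      length (A ++ concatMap fresh A)         <⟨ n<1+n _ ⟩
      length ball                             ≤⟨ unique⇒length≤ ball-unique ⟩
      c * s                                   ∎
      where open ≤-Reasoning

  open Ball public using (moore-bound)

-- Upper bound

degree-from-codegree : ∀ {s k n x d e} → s + k + n ≤ x → x ≤ s + (d + e) → e < n → suc k ≤ d
degree-from-codegree {s} {k} {n} {x} {d} {e} h₁ h₂ e<n =
  +-cancelʳ-≤ e (suc k) d (+-cancelˡ-≤ s _ _ (begin
    s + (suc k + e)  ≡⟨ cong (s +_) (+-suc k e) ⟨
    s + (k + suc e)  ≤⟨ +-monoʳ-≤ s (+-monoʳ-≤ k e<n) ⟩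
    s + (k + n)      ≡⟨ +-assoc s k n ⟨
    s + k + n        ≤⟨ h₁ ⟩
    x                ≤⟨ h₂ ⟩
    s + (d + e)      ∎))
  where open ≤-Reasoning

ramsey-upper : ∀ {c s} n k → Vertex c s → s + k + n ≤ c * s → c * s ≤ suc k * k → RamseyProp s n c
ramsey-upper {c} {s} n k v cs-large cs-small H = c4-or-star
  where
  open Vertices c s
  open Neighbourhoods H
  c4-or-star : HasC4 H ⊎ CoHasStar n H
  c4-or-star with hasC4? | any-vertex? (λ u → n ≤? length (coNbrs u))
  ... | yes c4   | _             = inj₁ c4
  ... | no _     | yes (u , n≤)  = inj₂ (coStar u n≤)
  ... | no noC4  | no no-star    = ⊥-elim (<⇒≱ (C4Free.moore-bound {H = H} noC4 k deg≥ v) cs-small)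
    where
    deg≥ : ∀ u → suc k ≤ length (nbrs u)
    deg≥ u = degree-from-codegree cs-large (cs≤s+deg+codeg u) (≰⇒> (λ n≤ → no-star (u , n≤)))

-- Lower bound: a Hamiltonian cycle of K_{c×s}

star+nbrs≤ : ∀ {c s n} (H : Subgraph (suc c) s) (star : CoHasStar n H) →
  ∀ {ws} → Unique ws → All (HEdge H (proj₁ star)) ws → n + length ws ≤ c * s
star+nbrs≤ {c} {s} {n} H (v , f , f-injective , _ , f-coedge) {ws} ws! ws-edges =
  subst (_≤ c * s) length-leaves++ws (otherClasses⇒length≤ {v = v} leaves++ws-unique
    (++⁺ (All.map proj₁ leaves-coedges) (All.map proj₁ ws-edges)))
  where
  leaves = map f (allFin n)
  leaves-coedges : All (CoEdge H v) leaves
  leaves-coedges = All.tabulate λ z∈ → let i , _ , z≡fi = ∈-map⁻ f z∈ in subst (CoEdge H v) (sym z≡fi) (f-coedge i)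
  leaves++ws-unique : Unique (leaves ++ ws)
  leaves++ws-unique = Unique.++⁺ (Unique.map⁺ f-injective (Unique.allFin⁺ n)) ws! λ (z∈leaves , z∈ws) →
    𝔹.not-¬ (proj₂ (All.lookup leaves-coedges z∈leaves)) (proj₂ (All.lookup ws-edges z∈ws))
  length-leaves++ws : length (leaves ++ ws) ≡ n + length ws
  length-leaves++ws = trans (length-++ leaves) (cong (_+ length ws) (trans (length-map f (allFin n)) (length-tabulate (λ i → i))))

module Cycle (L : ℕ) where

  -- The closing edge L − 1 ↦ 0 exists only for L ≥ 5: shorter closed cycles
  -- would contain a C4 or a double edge, so for L ≤ 4 the graph is a path.
  data _↦_ : ℕ → ℕ → Set where
    step : ∀ {p} → p ↦ suc p
    wrap : ∀ {p} → 5 ≤ L → suc p ≡ L → p ↦ 0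

  _↦?_ : ∀ p q → Dec (p ↦ q)
  p ↦? zero = map′ (uncurry wrap) (λ { (wrap 5≤L e) → 5≤L , e }) (5 ≤? L ×-dec suc p ≟ L)
  p ↦? suc q = map′ (λ { refl → step }) (λ { step → refl }) (p ≟ q)

  _∼_ : ℕ → ℕ → Set
  p ∼ q = p ↦ q ⊎ q ↦ p

  _∼?_ : ∀ p q → Dec (p ∼ q)
  p ∼? q = p ↦? q ⊎-dec q ↦? p

  ∼-sym : ∀ {p q} → p ∼ q → q ∼ p
  ∼-sym = Sum.swap

  ↦-rise : ∀ {p q} → p ↦ q → q ≤ suc p
  ↦-rise step = ≤-refl
  ↦-rise (wrap _ _) = z≤n

  ↦-rise³ : ∀ {a b c d} → a ↦ b → b ↦ c → c ↦ d → d ≤ 3 + a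
  ↦-rise³ ab bc cd = ≤-trans (↦-rise cd) (s≤s (≤-trans (↦-rise bc) (s≤s (↦-rise ab))))

  wrap-source>3 : ∀ {p} → 5 ≤ L → suc p ≡ L → 3 < p
  wrap-source>3 5≤L refl = s≤s⁻¹ 5≤L

  no-2-cycle : ∀ {a b} → a ↦ b → b ↦ a → ⊥
  no-2-cycle (wrap 5≤L e) ba = <⇒≱ (wrap-source>3 5≤L e) (≤-trans (↦-rise ba) (s≤s z≤n))
  no-2-cycle step (wrap 5≤L e) = <⇒≱ (wrap-source>3 5≤L e) (s≤s z≤n)

  -- A closed walk rises by at most one per step, so it needs a wrap, which falls by L − 1 ≥ 4.
  no-4-cycle : ∀ {a b c d} → a ↦ b → b ↦ c → c ↦ d → d ↦ a → ⊥
  no-4-cycle (wrap 5≤L e) bc cd da = <⇒≱ (wrap-source>3 5≤L e) (↦-rise³ bc cd da)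
  no-4-cycle step (wrap 5≤L e) cd da = <⇒≱ (wrap-source>3 5≤L e) (↦-rise³ cd da step)
  no-4-cycle step step (wrap 5≤L e) da = <⇒≱ (wrap-source>3 5≤L e) (↦-rise³ da step step)
  no-4-cycle step step step (wrap 5≤L e) = <⇒≱ (wrap-source>3 5≤L e) (↦-rise³ step step step)

  ↦-functional : ∀ {p q q'} → q < L → q' < L → p ↦ q → p ↦ q' → q ≡ q'
  ↦-functional _ _ step step = refl
  ↦-functional q<L _ step (wrap _ e) = ⊥-elim (<-irrefl e q<L)
  ↦-functional _ q'<L (wrap _ e) step = ⊥-elim (<-irrefl e q'<L)
  ↦-functional _ _ (wrap _ _) (wrap _ _) = refl

  ↦-injective : ∀ {p p' q} → p ↦ q → p' ↦ q → p ≡ p'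
  ↦-injective step step = refl
  ↦-injective (wrap _ e) (wrap _ e') = suc-injective (trans e (sym e'))

  no-square : ∀ {a b c d} → a < L → b < L → c < L → d < L → a ≢ c → b ≢ d →
    a ∼ b → b ∼ c → c ∼ d → d ∼ a → ⊥
  no-square _ b<L _ d<L a≢c b≢d (inj₁ ab) bc cd da = oriented b<L d<L a≢c b≢d ab bc cd da
    where
    oriented : ∀ {a b c d} → b < L → d < L → a ≢ c → b ≢ d → a ↦ b → b ∼ c → c ∼ d → d ∼ a → ⊥
    oriented _ _ a≢c _ ab (inj₂ cb) _ _ = a≢c (↦-injective ab cb)
    oriented _ _ _ b≢d _ (inj₁ bc) (inj₂ dc) _ = b≢d (↦-injective bc dc)
    oriented _ _ _ _ ab (inj₁ bc) (inj₁ cd) (inj₁ da) = no-4-cycle ab bc cd da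
    oriented b<L d<L _ b≢d ab (inj₁ _) (inj₁ _) (inj₂ ad) = b≢d (↦-functional b<L d<L ab ad)
  no-square a<L b<L c<L d<L a≢c b≢d (inj₂ ba) bc cd da =
    no-square b<L a<L d<L c<L b≢d a≢c (inj₁ ba) (∼-sym da) (∼-sym cd) (∼-sym bc)

  successor : 5 ≤ L → ∀ {p} → p < L → ∃ λ q → q < L × p ↦ q
  successor 5≤L {p} p<L with suc p <? L
  ... | yes 1+p<L = suc p , 1+p<L , step
  ... | no 1+p≮L = 0 , ≤-trans (s≤s z≤n) p<L , wrap 5≤L (≤-antisym p<L (≮⇒≥ 1+p≮L))

  predecessor : 5 ≤ L → ∀ {p} → p < L → ∃ λ q → q < L × q ↦ p
  predecessor 5≤L {zero} _ = pred L , ≤-reflexive (suc-pred L) , wrap 5≤L (suc-pred L)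
    where instance _ = >-nonZero (≤-trans (s≤s z≤n) 5≤L)
  predecessor _ {suc p} 1+p<L = p , <-trans (n<1+n p) 1+p<L , step

  some-neighbour : 2 ≤ L → ∀ {p} → p < L → ∃ λ q → q < L × p ∼ q
  some-neighbour _ {p} p<L with suc p <? L
  ... | yes 1+p<L = suc p , 1+p<L , inj₁ step
  some-neighbour 2≤L {zero} _ | no 1≮L = ⊥-elim (1≮L 2≤L)
  some-neighbour _ {suc p} 1+p<L | no _ = p , <-trans (n<1+n p) 1+p<L , inj₂ step

gap-divisible : ∀ {c x y i k} → suc (c * x + i) ≡ c * y + i + k * c → c ∣ 1
gap-divisible {c} {x} {y} {i} {k} eq =
  ∣m+n∣m⇒∣n (subst (c ∣_) cy+kc≡cx+1 (∣m∣n⇒∣m+n (m∣m*n y) (n∣m*n k))) (m∣m*n x)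
  where
  open CSProps +-commutativeSemigroup using (xy∙z≈xz∙y)
  cy+kc≡cx+1 : c * y + k * c ≡ c * x + 1
  cy+kc≡cx+1 = +-cancelʳ-≡ i _ _ (begin
    c * y + k * c + i  ≡⟨ xy∙z≈xz∙y (c * y) (k * c) i ⟩
    c * y + i + k * c  ≡⟨ eq ⟨
    suc (c * x + i)    ≡⟨ +-suc (c * x) i ⟨
    c * x + suc i      ≡⟨ +-assoc (c * x) 1 i ⟨
    c * x + 1 + i      ∎)
    where open ≡-Reasoning

-- Vertex (i , x) sits at position x c + i, so consecutive positions lie in different classes.
module CycleGraph (c s : ℕ) where
  open Vertices c s
  open Cycle (s * c)

  position : V → ℕ
  position (i , x) = toℕ (combine x i)

  position< : ∀ v → position v < s * c
  position< (i , x) = FP.toℕ<n (combine x i)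

  position-injective : ∀ {u w} → position u ≡ position w → u ≡ w
  position-injective {i , x} {j , y} eq with FP.combine-injective x i y j (FP.toℕ-injective eq)
  ... | refl , refl = refl

  vertexAt : ∀ {q} → q < s * c → V
  vertexAt q<L = swap (remQuot {s} c (fromℕ< q<L))

  position-vertexAt : ∀ {q} (q<L : q < s * c) → position (vertexAt q<L) ≡ q
  position-vertexAt q<L = trans (cong toℕ (FP.combine-remQuot {s} c (fromℕ< q<L))) (FP.toℕ-fromℕ< q<L)

  ↦⇒gap : ∀ {p q} → p ↦ q → ∃ λ k → suc p ≡ q + k * c
  ↦⇒gap step = 0 , sym (+-identityʳ _)
  ↦⇒gap (wrap _ e) = s , e

  gap⇒differentClass : 2 ≤ c → ∀ {u w} → (∃ λ k → suc (position u) ≡ position w + k * c) → classOf u ≢ classOf w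
  gap⇒differentClass 2≤c {i , x} {.i , y} (k , eq) refl = <⇒≢ 2≤c (sym (∣1⇒≡1 (gap-divisible {k = k}
    (subst₂ (λ a b → suc a ≡ b + k * c) (FP.toℕ-combine x i) (FP.toℕ-combine y i) eq))))

  cycleGraph : Subgraph c s
  cycleGraph = record
    { adj = λ u w → does (position u ∼? position w)
    ; sym = λ u w → does-⇔ (mk⇔ ∼-sym ∼-sym) (position u ∼? position w) (position w ∼? position u)
    }

  HEdge⇒∼ : ∀ {u w} → HEdge cycleGraph u w → position u ∼ position w
  HEdge⇒∼ {u} {w} (_ , adj≡true) = does-true (position u ∼? position w) adj≡true
    where
    does-true : ∀ {P : Set} (P? : Dec P) → does P? ≡ true → P
    does-true (yes p) _ = p

  ∼⇒HEdge : 2 ≤ c → ∀ {u w} → position u ∼ position w → HEdge cycleGraph u w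
  ∼⇒HEdge 2≤c {u} {w} u∼w = different-classes u∼w , dec-true (position u ∼? position w) u∼w
    where
    different-classes : position u ∼ position w → KEdge u w
    different-classes (inj₁ u↦w) = gap⇒differentClass 2≤c (↦⇒gap u↦w)
    different-classes (inj₂ w↦u) = gap⇒differentClass 2≤c (↦⇒gap w↦u) ∘ sym

  cycleGraph-C4-free : ¬ HasC4 cycleGraph
  cycleGraph-C4-free (v₀ , v₁ , v₂ , v₃ , _ , v₀≢v₂ , _ , _ , v₁≢v₃ , _ , e₀₁ , e₁₂ , e₂₃ , e₃₀) =
    no-square (position< v₀) (position< v₁) (position< v₂) (position< v₃)
      (v₀≢v₂ ∘ position-injective) (v₁≢v₃ ∘ position-injective)
      (HEdge⇒∼ e₀₁) (HEdge⇒∼ e₁₂) (HEdge⇒∼ e₂₃) (HEdge⇒∼ e₃₀)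

  neighbourAt : 2 ≤ c → ∀ v {q} (q<L : q < s * c) → position v ∼ q → HEdge cycleGraph v (vertexAt q<L)
  neighbourAt 2≤c v q<L v∼q = ∼⇒HEdge 2≤c (subst (position v ∼_) (sym (position-vertexAt q<L)) v∼q)

  one-neighbour : 2 ≤ c → 2 ≤ s * c → ∀ v → ∃ (HEdge cycleGraph v)
  one-neighbour 2≤c 2≤L v =
    let q , q<L , v∼q = some-neighbour 2≤L (position< v) in vertexAt q<L , neighbourAt 2≤c v q<L v∼q

  two-neighbours : 2 ≤ c → 5 ≤ s * c → ∀ v → ∃₂ λ w w' → w ≢ w' × HEdge cycleGraph v w × HEdge cycleGraph v w'
  two-neighbours 2≤c 5≤L v =
    vertexAt q<L , vertexAt q'<L , next≢prev ,
    neighbourAt 2≤c v q<L (inj₁ v↦q) , neighbourAt 2≤c v q'<L (inj₂ q'↦v)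
    where
    next = successor 5≤L (position< v)
    prev = predecessor 5≤L (position< v)
    q<L = proj₁ (proj₂ next)
    v↦q = proj₂ (proj₂ next)
    q'<L = proj₁ (proj₂ prev)
    q'↦v = proj₂ (proj₂ prev)
    next≢prev : vertexAt q<L ≢ vertexAt q'<L
    next≢prev eq = no-2-cycle v↦q (subst (_↦ position v) q'≡q q'↦v)
      where
      q'≡q = trans (sym (position-vertexAt q'<L)) (trans (cong position (sym eq)) (position-vertexAt q<L))

cycleGraph-no-coStar : ∀ {s n c} → 2 ≤ s → 2 ≤ n → c * s ≤ n + 1 + s → ¬ CoHasStar n (CycleGraph.cycleGraph c s)
cycleGraph-no-coStar {c = zero} _ _ _ ((() , _) , _)
cycleGraph-no-coStar {s} {n} {suc zero} _ 2≤n _ star =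
  <⇒≱ (≤-trans (s≤s z≤n) 2≤n) (≤-trans (m≤m+n n 0) (star+nbrs≤ (CycleGraph.cycleGraph 1 s) star [] []))
cycleGraph-no-coStar {s} {n} {suc (suc c)} 2≤s 2≤n cs≤ star@(v , _) = too-few-vertices (5 ≤? L)
  where
  open CycleGraph (suc (suc c)) s
  L = s * suc (suc c)
  2≤c : 2 ≤ suc (suc c)
  2≤c = s≤s (s≤s z≤n)
  star+nbrs≤c*s : ∀ {ws} → Unique ws → All (HEdge cycleGraph v) ws → n + length ws ≤ suc c * s
  star+nbrs≤c*s = star+nbrs≤ cycleGraph star
  too-few-vertices : Dec (5 ≤ L) → ⊥
  too-few-vertices (yes 5≤L) =
    let _ , _ , w≢w' , vw , vw' = two-neighbours 2≤c 5≤L v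
    in <⇒≱ (+-monoʳ-< n (n<1+n 1)) (≤-trans (star+nbrs≤c*s ((w≢w' ∷ []) ∷ [] ∷ []) (vw ∷ vw' ∷ []))
         (+-cancelˡ-≤ s _ _ (≤-trans cs≤ (≤-reflexive (+-comm (n + 1) s)))))
  too-few-vertices (no 5≰L) =
    let _ , vw = one-neighbour 2≤c (≤-trans 2≤s (m≤m*n s (suc (suc c)))) v
    in 5≰L (begin
      2 + (2 + 1)      ≤⟨ +-mono-≤ 2≤s (+-monoˡ-≤ 1 2≤n) ⟩
      s + (n + 1)      ≤⟨ +-monoʳ-≤ s (star+nbrs≤c*s ([] ∷ []) (vw ∷ [])) ⟩
      s + suc c * s    ≡⟨ *-comm (suc (suc c)) s ⟩
      L                ∎)
    where open ≤-Reasoning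

ramsey-lower : ∀ {s n c} → 2 ≤ s → 2 ≤ n → c * s ≤ n + 1 + s → ¬ RamseyProp s n c
ramsey-lower {s} {n} {c} 2≤s 2≤n cs≤ ramsey =
  Sum.[ CycleGraph.cycleGraph-C4-free c s , cycleGraph-no-coStar 2≤s 2≤n cs≤ ] (ramsey (CycleGraph.cycleGraph c s))

slack-sum : ∀ s n m k → k + n ≡ m * s → s + k + n ≡ (m + 1) * s
slack-sum s n m k k+n≡ms = begin
  s + k + n    ≡⟨ +-assoc s k n ⟩
  s + (k + n)  ≡⟨ cong (s +_) k+n≡ms ⟩
  s + m * s    ≡⟨ cong (_* s) (+-comm m 1) ⟨
  (m + 1) * s  ∎
  where open ≡-Reasoning

slack-square : ∀ s n m k → k + n ≡ m * s → n + s ≤ k * k → (m + 1) * s ≤ suc k * k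
slack-square s n m k k+n≡ms n+s≤k² = begin
  (m + 1) * s  ≡⟨ slack-sum s n m k k+n≡ms ⟨
  s + k + n    ≡⟨ cong (_+ n) (+-comm s k) ⟩
  k + s + n    ≡⟨ +-assoc k s n ⟩
  k + (s + n)  ≡⟨ cong (k +_) (+-comm s n) ⟩
  k + (n + s)  ≤⟨ +-monoʳ-≤ k n+s≤k² ⟩
  k + k * k    ∎
  where open ≤-Reasoning

∸1<⇒≤ : ∀ x {y} → x ∸ 1 < y → x ≤ y
∸1<⇒≤ zero _ = z≤n
∸1<⇒≤ (suc x) x<y = x<y

≤/+1⇒*≤+ : ∀ {c x s} .{{_ : NonZero s}} → c ≤ x / s + 1 → c * s ≤ x + s
≤/+1⇒*≤+ {c} {x} {s} c≤ = begin
  c * s              ≤⟨ *-monoˡ-≤ s c≤ ⟩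
  (x / s + 1) * s    ≡⟨ *-distribʳ-+ s (x / s) 1 ⟩
  x / s * s + 1 * s  ≡⟨ cong (x / s * s +_) (*-identityˡ s) ⟩
  x / s * s + s      ≤⟨ +-monoˡ-≤ s (m/n*n≤m x s) ⟩
  x + s              ∎
  where open ≤-Reasoning

proposition3p2 : (s n : ℕ) → .{{_ : NonZero s}} → 2 ≤ s → 2 ≤ n →
    (m : ℕ) → IsCeilNSqrtDiv s n (n + s ∸ 1) m →
    ¬ NSqrtDivIsInteger s n (n + s ∸ 1) →
    m ≤ (n + 1) / s + 1 →
    MsnIs s n (m + 1)
proposition3p2 s n 2≤s 2≤n m ((n≤ms , t≤k²) , _) not-integer m≤ =
  m≤n+m 1 m , ramsey-upper n k corner (≤-reflexive (slack-sum s n m k k+n≡ms)) (slack-square s n m k k+n≡ms n+s≤k²) , lower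
  where
  k = m * s ∸ n
  k+n≡ms : k + n ≡ m * s
  k+n≡ms = m∸n+n≡m n≤ms
  n+s≤k² : n + s ≤ k * k
  n+s≤k² = subst (n + s ≤_) (cong (k *_) (*-identityʳ k))
    (∸1<⇒≤ (n + s) (≤∧≢⇒< t≤k² λ t≡k² → not-integer (m , n≤ms , sym t≡k²)))
  corner : Vertex (m + 1) s
  corner = fromℕ< (m≤n+m 1 m) , fromℕ< (≤-trans (s≤s z≤n) 2≤s)
  lower : ∀ c → 1 ≤ c → c < m + 1 → ¬ RamseyProp s n c
  lower c _ c<m+1 = ramsey-lower 2≤s 2≤n (≤/+1⇒*≤+ (≤-trans (m<1+n⇒m≤n (subst (c <_) (+-comm m 1) c<m+1)) m≤))
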